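{- If $T$ is a (finite, unrooted) tree, then $\chi_D(T)\le D(T)+1$.
   Context: A coloring of $T$ is distinguishing if no nontrivial automorphism of $T$ preserves all vertex colors, and proper if adjacent vertices receive different colors. $D(T)$ is the minimum number of colors in a distinguishing coloring of $T$, and $\chi_D(T)$ is the minimum number of colors in a proper distinguishing coloring of $T$. -}

module Defs where

open import Data.Nat using (ℕ; zero; suc; _+_; _≤_)
open import Data.Fin using (Fin; zero; suc; inject₁; fromℕ)
open import Data.Product using (Σ; ∃; _×_; _,_)
open import Relation.Binary.PropositionalEquality using (_≡_; _≢_)
open import Relation.Nullary using (¬_)
open import Function.Bundles using (_↔_; Inverse)
open import Function.Definitions using (Injective)
open import Level using (0ℓ)

record Graph (n : ℕ) : Set₁ where
  field
    Adj   : Fin n → Fin n → Set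
    sym   : ∀ {u v} → Adj u v → Adj v u
    irref : ∀ {v} → ¬ Adj v v
open Graph public

data Walk {n : ℕ} (G : Graph n) : Fin n → Fin n → Set where
  here : ∀ {v} → Walk G v v
  step : ∀ {u w v} → Adj G u w → Walk G w v → Walk G u v

Connected : ∀ {n} → Graph n → Set
Connected G = ∀ u v → Walk G u v

-- A cycle: k ≥ 3 distinct vertices c 0, ..., c (k-1) with c i ~ c (i+1)
-- and c (k-1) ~ c 0.   Here k = 3 + m.
record Cycle {n : ℕ} (G : Graph n) : Set where
  field
    m      : ℕ
    c      : Fin (3 + m) → Fin n
    inj    : Injective _≡_ _≡_ c
    edges  : ∀ (i : Fin (2 + m)) → Adj G (c (inject₁ i)) (c (suc i))
    close  : Adj G (c (fromℕ (2 + m))) (c zero)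

Acyclic : ∀ {n} → Graph n → Set
Acyclic G = ¬ Cycle G

IsTree : ∀ {n} → Graph n → Set
IsTree G = Connected G × Acyclic G

record Automorphism {n : ℕ} (G : Graph n) : Set where
  field
    perm     : Fin n ↔ Fin n
    preserve : ∀ u v → (Adj G u v → Adj G (Inverse.to perm u) (Inverse.to perm v))
                     × (Adj G (Inverse.to perm u) (Inverse.to perm v) → Adj G u v)
open Automorphism public

aut : ∀ {n} {G : Graph n} → Automorphism G → Fin n → Fin n
aut σ = Inverse.to (perm σ)

Coloring : ℕ → ℕ → Set
Coloring n k = Fin n → Fin k

Distinguishing : ∀ {n k} (G : Graph n) → Coloring n k → Set
Distinguishing G c = ∀ (σ : Automorphism G) → (∀ v → c (aut σ v) ≡ c v) → ∀ v → aut σ v ≡ v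

Proper : ∀ {n k} (G : Graph n) → Coloring n k → Set
Proper G c = ∀ u v → Adj G u v → c u ≢ c v

HasDistColoring : ∀ {n} → Graph n → ℕ → Set
HasDistColoring {n} G k = Σ (Coloring n k) λ c → Distinguishing G c

HasProperDistColoring : ∀ {n} → Graph n → ℕ → Set
HasProperDistColoring {n} G k = Σ (Coloring n k) λ c → Proper G c × Distinguishing G c

IsDistNumber : ∀ {n} → Graph n → ℕ → Set
IsDistNumber G d = HasDistColoring G d × (∀ k → HasDistColoring G k → d ≤ k)

IsDistChromaticNumber : ∀ {n} → Graph n → ℕ → Set
IsDistChromaticNumber G x = HasProperDistColoring G x × (∀ k → HasProperDistColoring G k → x ≤ k)

module Submission where

-- Pick a centre r of T, a vertex of minimum eccentricity; every automorphism maps r to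
-- r or to a neighbour of r.  Root T at r and, going down from the root, recolour a
-- distinguishing colouring c with d colours: a vertex keeps its colour unless that
-- colour equals the new colour of its parent, in which case it gets the fresh colour d.
-- The new colouring c' is proper, so an automorphism preserving c' cannot move r to a
-- neighbour.  It therefore fixes r and commutes with the parent map, hence preserves c,
-- since c v can be read off from c' v and c' (parent v); so it is the identity.

open import Defs renaming (sym to adj-sym)
open import Data.Bool using (Bool; true; false)
open import Data.Fin using (Fin; zero; suc; inject₁; fromℕ; _≟_)
open import Data.Fin.Properties using (fromℕ≢inject₁; inject₁-injective)
open import Data.List using (List; []; _∷_; _++_; length; lookup; allFin)
open import Data.List.Extrema.Nat
  using (argmin; argmax; f[argmin]≤f[xs]; f[xs]≤f[argmax]; f[argmax]≤v⁺; f[argmax]<v⁺)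
open import Data.List.Membership.Propositional using (_∈_; _∉_)
open import Data.List.Membership.Propositional.Properties using (∈-allFin; ∈-lookup; ∈-++⁻)
open import Data.List.Properties using (length-++)
open import Data.List.Relation.Unary.All as All using (All; []; _∷_)
open import Data.List.Relation.Unary.All.Properties using (¬Any⇒All¬)
open import Data.List.Relation.Unary.AllPairs using ([]; _∷_)
open import Data.List.Relation.Unary.Any using (here; there)
open import Data.List.Relation.Unary.Unique.Propositional using (Unique)
open import Data.List.Relation.Unary.Unique.Propositional.Properties using (++⁺)
open import Data.Nat using (ℕ; zero; suc; _+_; _≤_; _<_; z≤n; s≤s)
open import Data.Nat.Properties
  using (≤-refl; ≤-trans; ≤-reflexive; ≤-antisym; ≤-total; <⇒≤; <⇒≢; <⇒≱; <-≤-trans; ≤-<-trans; n≤1+n;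
         n≤0⇒n≡0; ≤-pred; m≢1+n+m; +-suc; +-comm; +-monoˡ-≤; module ≤-Reasoning)
open import Data.Product using (Σ; _×_; _,_; proj₁; proj₂)
open import Data.Sum as Sum using (_⊎_; inj₁; inj₂; [_,_])
open import Data.Vec.Functional using (updateAt)
open import Data.Vec.Functional.Properties using (updateAt-updates; updateAt-minimal)
open import Function using (id; const; _∘_; case_of_)
open import Function.Bundles using (Inverse)
open import Relation.Nullary using (¬_; Dec; yes; no; does; contradiction)
open import Relation.Nullary.Decidable
  using (dec-true; dec-false; decidable-stable; ¬?; _×-dec_; _⊎-dec_)
open import Relation.Binary.PropositionalEquality
  using (_≡_; _≢_; refl; sym; trans; cong; cong₂; subst; subst₂; module ≡-Reasoning)

avoid : ∀ {d} → Fin d → Fin (suc d) → Fin (suc d)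
avoid {d} i q with inject₁ i ≟ q
... | yes _ = fromℕ d
... | no _  = inject₁ i

avoid-≢ : ∀ {d} (i : Fin d) q → avoid i q ≢ q
avoid-≢ i q with inject₁ i ≟ q
... | yes i≡q = λ fresh≡q → fromℕ≢inject₁ (trans fresh≡q (sym i≡q))
... | no i≢q  = i≢q

-- Knowing q, the original colour is recovered: the fresh colour can only stand for q.
recover : ∀ {d} → Fin (suc d) → Fin (suc d) → Fin (suc d)
recover {d} a q with a ≟ fromℕ d
... | yes _ = q
... | no _  = a

recover-avoid : ∀ {d} (i : Fin d) q → recover (avoid i q) q ≡ inject₁ i
recover-avoid {d} i q with inject₁ i ≟ q
... | yes i≡q with fromℕ d ≟ fromℕ d
...   | yes _ = sym i≡q
...   | no ≢refl = contradiction refl ≢refl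
recover-avoid {d} i q | no _ with inject₁ i ≟ fromℕ d
...   | yes i≡fresh = contradiction (sym i≡fresh) fromℕ≢inject₁
...   | no _ = refl

set : ∀ {n} {A : Set} → (Fin n → A) → Fin n → A → Fin n → A
set f w a = updateAt f w (const a)

set-here : ∀ {n} {A : Set} (f : Fin n → A) w a → set f w a w ≡ a
set-here f w a = updateAt-updates w f

set-elsewhere : ∀ {n} {A : Set} (f : Fin n → A) {w} a {v} → v ≢ w → set f w a v ≡ f v
set-elsewhere f {w} a {v} = updateAt-minimal v w f

lookup-injective : ∀ {A : Set} {xs : List A} → Unique xs → ∀ i j → lookup xs i ≡ lookup xs j → i ≡ j
lookup-injective {xs = _ ∷ _} _ zero zero _ = refl
lookup-injective {xs = _ ∷ xs} (x∉ ∷ _) zero (suc j) x≡ =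
  contradiction x≡ (All.lookup x∉ (∈-lookup {xs = xs} j))
lookup-injective {xs = _ ∷ xs} (x∉ ∷ _) (suc i) zero ≡x =
  contradiction (sym ≡x) (All.lookup x∉ (∈-lookup {xs = xs} i))
lookup-injective {xs = _ ∷ _} (_ ∷ unique) (suc i) (suc j) e = cong suc (lookup-injective unique i j e)

module _ {n : ℕ} (G : Graph n) where

  record SpanningTree (x : Fin n) : Set where
    field
      parent       : Fin n → Fin n
      depth        : Fin n → ℕ
      depth-root   : depth x ≡ 0
      parent-adj   : ∀ v → v ≢ x → Adj G (parent v) v
      depth-parent : ∀ v → v ≢ x → depth v ≡ suc (depth (parent v))

    TreeEdge : Fin n → Fin n → Set
    TreeEdge u v = (v ≢ x × parent v ≡ u) ⊎ (u ≢ x × parent u ≡ v)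

    tree-edge? : ∀ u v → Dec (TreeEdge u v)
    tree-edge? u v = (¬? (v ≟ x) ×-dec parent v ≟ u) ⊎-dec (¬? (u ≟ x) ×-dec parent u ≟ v)

    hangs-from : ∀ {v p} → v ≢ x → parent v ≡ p → Adj G p v
    hangs-from {v} v≢x refl = parent-adj v v≢x

    shallower : ∀ v → v ≢ x → depth (parent v) < depth v
    shallower v v≢x = ≤-reflexive (sym (depth-parent v v≢x))

    higher-≢ : ∀ {u v} → depth u < depth v → u ≢ v
    higher-≢ u<v u≡v = <⇒≢ u<v (cong depth u≡v)

    depth-zero : ∀ v → depth v ≡ 0 → v ≡ x
    depth-zero v dv≡0 with v ≟ x
    ... | yes v≡x = v≡x
    ... | no v≢x  = contradiction (trans (sym dv≡0) (depth-parent v v≢x)) λ ()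

    deeper-not-root : ∀ {u v} → u ≢ v → depth u ≤ depth v → v ≢ x
    deeper-not-root {u} u≢v u≤v refl =
      u≢v (depth-zero u (n≤0⇒n≡0 (subst (depth u ≤_) depth-root u≤v)))

  record PartialTree (x : Fin n) : Set where
    field
      reached      : Fin n → Bool
      parent       : Fin n → Fin n
      depth        : Fin n → ℕ
      root-reached : reached x ≡ true
      depth-root   : depth x ≡ 0
      closed       : ∀ v → reached v ≡ true → v ≢ x →
                     reached (parent v) ≡ true × Adj G (parent v) v × depth v ≡ suc (depth (parent v))
  open PartialTree using (reached; root-reached)

  _⊑_ : ∀ {x} → PartialTree x → PartialTree x → Set
  s ⊑ s' = ∀ v → reached s v ≡ true → reached s' v ≡ true

  rootOnly : ∀ x → PartialTree x
  rootOnly x = record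
    { reached = λ v → does (v ≟ x) ; parent = id ; depth = const 0
    ; root-reached = dec-true (x ≟ x) refl ; depth-root = refl
    ; closed = λ v v∈ v≢x → contradiction (trans (sym v∈) (dec-false (v ≟ x) v≢x)) λ () }

  attach : ∀ {x} (s : PartialTree x) {u w} → reached s u ≡ true → reached s w ≡ false →
           Adj G u w → Σ (PartialTree x) λ s' → s ⊑ s' × reached s' w ≡ true
  attach {x} s {u} {w} u∈ w∉ uw = s' , grows , set-here (reached s) w true
    where
    open PartialTree s using (parent; depth; depth-root; closed)
    apart : ∀ {v} → reached s v ≡ true → v ≢ w
    apart v∈ refl = contradiction (trans (sym v∈) w∉) λ ()
    depth' : Fin n → ℕ
    depth' = set depth w (suc (depth u))
    closed' : ∀ v → set (reached s) w true v ≡ true → v ≢ x →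
              set (reached s) w true (set parent w u v) ≡ true × Adj G (set parent w u v) v ×
              depth' v ≡ suc (depth' (set parent w u v))
    closed' v v∈ v≢x with v ≟ w
    ... | yes refl rewrite set-here parent v u | set-elsewhere (reached s) true (apart u∈)
                         | set-here depth v (suc (depth u)) | set-elsewhere depth (suc (depth u)) (apart u∈)
        = u∈ , uw , refl
    ... | no v≢w with closed v (trans (sym (set-elsewhere (reached s) true v≢w)) v∈) v≢x
    ...   | p∈ , pv , dv rewrite set-elsewhere parent u v≢w | set-elsewhere (reached s) true (apart p∈)
                               | set-elsewhere depth (suc (depth u)) v≢w
                               | set-elsewhere depth (suc (depth u)) (apart p∈)
        = p∈ , pv , dv
    s' : PartialTree x
    s' = record
      { reached = set (reached s) w true ; parent = set parent w u ; depth = depth'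
      ; root-reached = trans (set-elsewhere (reached s) true (apart (root-reached s))) (root-reached s)
      ; depth-root = trans (set-elsewhere depth (suc (depth u)) (apart (root-reached s))) depth-root
      ; closed = closed' }
    grows : s ⊑ s'
    grows v v∈ with v ≟ w
    ... | yes refl = set-here (reached s) v true
    ... | no v≢w = trans (set-elsewhere (reached s) true v≢w) v∈

  absorb : ∀ {x} (s : PartialTree x) {a v} → reached s a ≡ true → Walk G a v →
           Σ (PartialTree x) λ s' → s ⊑ s' × reached s' v ≡ true
  absorb s a∈ here = s , (λ _ → id) , a∈
  absorb s a∈ (step {w = w} aw walk) with reached s w in w-status
  ... | true  = absorb s w-status walk
  ... | false with attach s a∈ w-status aw
  ...   | s₁ , s⊑s₁ , w∈ with absorb s₁ w∈ walk
  ...     | s₂ , s₁⊑s₂ , v∈ = s₂ , (λ u → s₁⊑s₂ u ∘ s⊑s₁ u) , v∈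

  absorbAll : ∀ {x} → Connected G → (s : PartialTree x) (vs : List (Fin n)) →
              Σ (PartialTree x) λ s' → s ⊑ s' × All (λ v → reached s' v ≡ true) vs
  absorbAll conn s [] = s , (λ _ → id) , []
  absorbAll {x} conn s (v ∷ vs) with absorb s (root-reached s) (conn x v)
  ... | s₁ , s⊑s₁ , v∈ with absorbAll conn s₁ vs
  ...   | s₂ , s₁⊑s₂ , vs∈ = s₂ , (λ u → s₁⊑s₂ u ∘ s⊑s₁ u) , s₁⊑s₂ v v∈ ∷ vs∈

  complete : ∀ {x} (s : PartialTree x) → (∀ v → reached s v ≡ true) → SpanningTree x
  complete s everything = record
    { parent = parent ; depth = depth ; depth-root = depth-root
    ; parent-adj = λ v v≢x → proj₁ (proj₂ (closed v (everything v) v≢x))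
    ; depth-parent = λ v v≢x → proj₂ (proj₂ (closed v (everything v) v≢x)) }
    where open PartialTree s using (parent; depth; depth-root; closed)

  spanningTree : Connected G → ∀ x → SpanningTree x
  spanningTree conn x =
    let s , _ , reachedAll = absorbAll conn (rootOnly x) (allFin n)
    in complete s (λ v → All.lookup reachedAll (∈-allFin v))

  data Path : Fin n → List (Fin n) → Fin n → Set where
    single : ∀ {a} → Path a (a ∷ []) a
    extend : ∀ {b c W a} → Adj G b c → Path c W a → Path b (b ∷ W) a

  path-snoc : ∀ {b W a e} → Path b W a → Adj G a e → Path b (W ++ e ∷ []) e
  path-snoc single ae = extend ae single
  path-snoc (extend bc p) ae = extend bc (path-snoc p ae)

  path-edges : ∀ {b y ys a} → Path b (y ∷ ys) a → (i : Fin (length ys)) →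
               Adj G (lookup (y ∷ ys) (inject₁ i)) (lookup (y ∷ ys) (suc i))
  path-edges (extend bc single) zero = bc
  path-edges (extend bc (extend _ _)) zero = bc
  path-edges (extend _ p@(extend _ _)) (suc i) = path-edges p i

  path-last : ∀ {b y ys a} → Path b (y ∷ ys) a → lookup (y ∷ ys) (fromℕ (length ys)) ≡ a
  path-last single = refl
  path-last (extend _ p@single) = path-last p
  path-last (extend _ p@(extend _ _)) = path-last p

  path-long : ∀ {b W a} → Path b W a → a ≢ b → 2 ≤ length W
  path-long single a≢a = contradiction refl a≢a
  path-long (extend _ single) _ = s≤s (s≤s z≤n)
  path-long (extend _ (extend _ _)) _ = s≤s (s≤s z≤n)

  closeCycle : ∀ {b W a} → Path b W a → Adj G a b → Unique W → 3 ≤ length W → Cycle G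
  closeCycle {W = w₀ ∷ w₁ ∷ w₂ ∷ rest} p@(extend _ _) ab unique _ = record
    { m = length rest ; c = lookup (w₀ ∷ w₁ ∷ w₂ ∷ rest)
    ; inj = λ {i} {j} → lookup-injective unique i j
    ; edges = path-edges p
    ; close = subst (λ v → Adj G v w₀) (sym (path-last p)) ab }
  closeCycle {W = _ ∷ []} _ _ _ (s≤s ())
  closeCycle {W = _ ∷ _ ∷ []} _ _ _ (s≤s (s≤s ()))

  -- Every edge not in a spanning tree closes a cycle.  Starting from such an edge we keep
  -- a walk whose two ends climb towards the root, always the deeper end first, until one
  -- end becomes the parent of the other.
  module Climbing {x} (T : SpanningTree x) where
    open SpanningTree T

    record Admissible (b : Fin n) (W : List (Fin n)) (a : Fin n) : Set where
      field
        path       : Path b W a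
        unique     : Unique W
        distinct   : a ≢ b
        hanging    : ∀ w → w ∈ W → w ≡ a ⊎ w ≡ b ⊎ (depth a ≤ depth w × depth b ≤ depth w)
        nontrivial : 3 ≤ length W ⊎ ¬ TreeEdge b a
    open Admissible

    offWalk : ∀ {b W a y} → Admissible b W a → y ≢ a → y ≢ b →
              depth y < depth a ⊎ depth y < depth b → y ∉ W
    offWalk adm y≢a y≢b higher y∈ with hanging adm _ y∈
    ... | inj₁ y≡a = y≢a y≡a
    ... | inj₂ (inj₁ y≡b) = y≢b y≡b
    ... | inj₂ (inj₂ (a≤y , b≤y)) = [ (λ y<a → <⇒≱ y<a a≤y) , (λ y<b → <⇒≱ y<b b≤y) ] higher

    closeAtEnd : ∀ {b W a} → Admissible b W a → a ≢ x → parent a ≡ b → Cycle G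
    closeAtEnd adm a≢x pa≡b with nontrivial adm
    ... | inj₁ long = closeCycle (path adm) (adj-sym G (hangs-from a≢x pa≡b)) (unique adm) long
    ... | inj₂ ¬tree = contradiction (inj₁ (a≢x , pa≡b)) ¬tree

    closeAtStart : ∀ {b W a} → Admissible b W a → b ≢ x → parent b ≡ a → Cycle G
    closeAtStart adm b≢x pb≡a with nontrivial adm
    ... | inj₁ long = closeCycle (path adm) (hangs-from b≢x pb≡a) (unique adm) long
    ... | inj₂ ¬tree = contradiction (inj₂ (b≢x , pb≡a)) ¬tree

    extendAtEnd : ∀ {b W a} → Admissible b W a → a ≢ x → parent a ≢ b → depth b ≤ depth a →
                  Admissible b (W ++ parent a ∷ []) (parent a)
    extendAtEnd {b} {W} {a} adm a≢x pa≢b b≤a = record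
      { path = path-snoc (path adm) (adj-sym G (parent-adj a a≢x))
      ; unique = ++⁺ (unique adm) ([] ∷ []) λ { (pa∈W , here refl) → pa∉W pa∈W }
      ; distinct = pa≢b
      ; hanging = hanging'
      ; nontrivial = inj₁ (subst (3 ≤_) (sym (length-++ W))
                                 (+-monoˡ-≤ 1 (path-long (path adm) (distinct adm)))) }
      where
      pa<a : depth (parent a) < depth a
      pa<a = shallower a a≢x
      pa∉W : parent a ∉ W
      pa∉W = offWalk adm (higher-≢ pa<a) pa≢b (inj₁ pa<a)
      hanging' : ∀ w → w ∈ W ++ parent a ∷ [] →
                 w ≡ parent a ⊎ w ≡ b ⊎ (depth (parent a) ≤ depth w × depth b ≤ depth w)
      hanging' w w∈ with ∈-++⁻ W w∈
      ... | inj₂ (here refl) = inj₁ refl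
      ... | inj₁ w∈W with hanging adm w w∈W
      ...   | inj₁ refl = inj₂ (inj₂ (<⇒≤ pa<a , b≤a))
      ...   | inj₂ (inj₁ w≡b) = inj₂ (inj₁ w≡b)
      ...   | inj₂ (inj₂ (a≤w , b≤w)) = inj₂ (inj₂ (≤-trans (<⇒≤ pa<a) a≤w , b≤w))

    extendAtStart : ∀ {b W a} → Admissible b W a → b ≢ x → parent b ≢ a → depth a ≤ depth b →
                    Admissible (parent b) (parent b ∷ W) a
    extendAtStart {b} {W} {a} adm b≢x pb≢a a≤b = record
      { path = extend (parent-adj b b≢x) (path adm)
      ; unique = ¬Any⇒All¬ W pb∉W ∷ unique adm
      ; distinct = pb≢a ∘ sym
      ; hanging = hanging'
      ; nontrivial = inj₁ (s≤s (path-long (path adm) (distinct adm))) }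
      where
      pb<b : depth (parent b) < depth b
      pb<b = shallower b b≢x
      pb∉W : parent b ∉ W
      pb∉W = offWalk adm pb≢a (higher-≢ pb<b) (inj₂ pb<b)
      hanging' : ∀ w → w ∈ parent b ∷ W →
                 w ≡ a ⊎ w ≡ parent b ⊎ (depth a ≤ depth w × depth (parent b) ≤ depth w)
      hanging' w (here refl) = inj₂ (inj₁ refl)
      hanging' w (there w∈W) with hanging adm w w∈W
      ... | inj₁ w≡a = inj₁ w≡a
      ... | inj₂ (inj₁ refl) = inj₂ (inj₂ (a≤b , <⇒≤ pb<b))
      ... | inj₂ (inj₂ (a≤w , b≤w)) = inj₂ (inj₂ (a≤w , ≤-trans (<⇒≤ pb<b) b≤w))

    ClosesBelow : ℕ → Set
    ClosesBelow N = ∀ {b W a} → Admissible b W a → depth a + depth b < N → Cycle G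

    climbAtEnd : ∀ {N} → ClosesBelow N → ∀ {b W a} → Admissible b W a →
                 depth b ≤ depth a → depth a + depth b ≤ N → Cycle G
    climbAtEnd {N} closes {b} {W} {a} adm b≤a sum≤N = case parent a ≟ b of λ where
        (yes pa≡b) → closeAtEnd adm a≢x pa≡b
        (no pa≢b)  → closes (extendAtEnd adm a≢x pa≢b b≤a)
                            (subst (λ k → k + depth b ≤ N) (depth-parent a a≢x) sum≤N)
      where
      a≢x : a ≢ x
      a≢x = deeper-not-root (distinct adm ∘ sym) b≤a

    climbAtStart : ∀ {N} → ClosesBelow N → ∀ {b W a} → Admissible b W a →
                   depth a ≤ depth b → depth a + depth b ≤ N → Cycle G
    climbAtStart {N} closes {b} {W} {a} adm a≤b sum≤N = case parent b ≟ a of λ where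
        (yes pb≡a) → closeAtStart adm b≢x pb≡a
        (no pb≢a)  → closes (extendAtStart adm b≢x pb≢a a≤b)
                            (subst (_≤ N) (+-suc (depth a) _)
                                   (subst (λ k → depth a + k ≤ N) (depth-parent b b≢x) sum≤N))
      where
      b≢x : b ≢ x
      b≢x = deeper-not-root (distinct adm) a≤b

    climb : ∀ N → ClosesBelow N
    climb zero _ ()
    climb (suc N) {b} {W} {a} adm (s≤s sum≤N) with ≤-total (depth b) (depth a)
    ... | inj₁ b≤a = climbAtEnd (climb N) adm b≤a sum≤N
    ... | inj₂ a≤b = climbAtStart (climb N) adm a≤b sum≤N

    edgeWalk : ∀ {u v} → Adj G u v → ¬ TreeEdge u v → Admissible u (u ∷ v ∷ []) v
    edgeWalk {u} {v} uv ¬tree = record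
      { path = extend uv single
      ; unique = (u≢v ∷ []) ∷ [] ∷ []
      ; distinct = u≢v ∘ sym
      ; hanging = λ { _ (here refl) → inj₂ (inj₁ refl) ; _ (there (here refl)) → inj₁ refl }
      ; nontrivial = inj₂ ¬tree }
      where
      u≢v : u ≢ v
      u≢v refl = irref G uv

  acyclic-tree-edge : Acyclic G → ∀ {x} (T : SpanningTree x) →
                      ∀ u v → Adj G u v → SpanningTree.TreeEdge T u v
  acyclic-tree-edge acyclic T u v uv =
    decidable-stable (tree-edge? u v) λ ¬tree → acyclic (climb _ (edgeWalk uv ¬tree) ≤-refl)
    where open SpanningTree T
          open Climbing T

  -- A spanning tree containing every edge of G; its depth is the distance to the root.
  record RootedTree (x : Fin n) : Set where
    field
      spanning  : SpanningTree x
      tree-edge : ∀ u v → Adj G u v → SpanningTree.TreeEdge spanning u v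
    open SpanningTree spanning public

  rootedTree : IsTree G → ∀ x → RootedTree x
  rootedTree (conn , acyclic) x = record { spanning = T ; tree-edge = acyclic-tree-edge acyclic T }
    where
    T : SpanningTree x
    T = spanningTree conn x

  module _ {x} (R : RootedTree x) where
    open RootedTree R

    depth-edge : ∀ {u v} → Adj G u v → depth v ≤ suc (depth u)
    depth-edge {u} {v} uv with tree-edge u v uv
    ... | inj₁ (v≢x , refl) = ≤-reflexive (depth-parent v v≢x)
    ... | inj₂ (u≢x , refl) = ≤-trans (<⇒≤ (shallower u u≢x)) (n≤1+n _)

  depth-minimal : ∀ {x} (T : SpanningTree x) (R : RootedTree x) v →
                  RootedTree.depth R v ≤ SpanningTree.depth T v
  depth-minimal {x} T R v = below (SpanningTree.depth T v) v ≤-refl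
    where
    open SpanningTree T
    below : ∀ k v → depth v ≤ k → RootedTree.depth R v ≤ depth v
    below _ v _ with v ≟ x
    below _ v _ | yes refl = ≤-reflexive (trans (RootedTree.depth-root R) (sym depth-root))
    below zero v dv≤0 | no v≢x = contradiction (trans (sym (n≤0⇒n≡0 dv≤0)) (depth-parent v v≢x)) λ ()
    below (suc k) v dv≤k | no v≢x = begin
      RootedTree.depth R v                     ≤⟨ depth-edge R (parent-adj v v≢x) ⟩
      suc (RootedTree.depth R (parent v))      ≤⟨ s≤s (below k (parent v) pv≤k) ⟩
      suc (depth (parent v))                   ≡⟨ sym (depth-parent v v≢x) ⟩
      depth v                                  ∎
      where
      open ≤-Reasoning
      pv≤k : depth (parent v) ≤ k
      pv≤k = ≤-pred (subst (_≤ suc k) (depth-parent v v≢x) dv≤k)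

  depth-unique : ∀ {x y} → x ≡ y → (R : RootedTree x) (R' : RootedTree y) →
                 ∀ v → RootedTree.depth R v ≡ RootedTree.depth R' v
  depth-unique refl R R' v =
    ≤-antisym (depth-minimal (RootedTree.spanning R') R v) (depth-minimal (RootedTree.spanning R) R' v)

  parent-unique : ∀ {x y} → x ≡ y → (R : RootedTree x) (R' : RootedTree y) →
                  ∀ v → v ≢ x → RootedTree.parent R' v ≡ RootedTree.parent R v
  parent-unique refl R R' v v≢x with RootedTree.tree-edge R' _ v (RootedTree.parent-adj R v v≢x)
  ... | inj₁ (_ , e) = e
  ... | inj₂ (p≢x , e) = contradiction loop (m≢1+n+m (depth R v))
    where
    open RootedTree
    -- v would be the parent of its own parent
    loop : depth R v ≡ suc (suc (depth R v))
    loop = begin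
      depth R v                                ≡⟨ depth-parent R v v≢x ⟩
      suc (depth R (parent R v))               ≡⟨ cong suc (depth-unique refl R R' _) ⟩
      suc (depth R' (parent R v))              ≡⟨ cong suc (depth-parent R' _ p≢x) ⟩
      suc (suc (depth R' (parent R' (parent R v)))) ≡⟨ cong (λ p → suc (suc (depth R' p))) e ⟩
      suc (suc (depth R' v))                   ≡⟨ cong (λ k → suc (suc k)) (depth-unique refl R' R v) ⟩
      suc (suc (depth R v))                    ∎
      where open ≡-Reasoning

  aut⁻¹ : Automorphism G → Fin n → Fin n
  aut⁻¹ σ = Inverse.from (perm σ)

  aut-aut⁻¹ : ∀ (σ : Automorphism G) y → aut σ (aut⁻¹ σ y) ≡ y
  aut-aut⁻¹ σ y = Inverse.inverseˡ (perm σ) refl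

  aut⁻¹-aut : ∀ (σ : Automorphism G) y → aut⁻¹ σ (aut σ y) ≡ y
  aut⁻¹-aut σ y = Inverse.inverseʳ (perm σ) refl

  aut-injective : ∀ (σ : Automorphism G) {u v} → aut σ u ≡ aut σ v → u ≡ v
  aut-injective σ {u} {v} e = trans (sym (aut⁻¹-aut σ u)) (trans (cong (aut⁻¹ σ) e) (aut⁻¹-aut σ v))

  aut-adj : ∀ (σ : Automorphism G) {u v} → Adj G u v → Adj G (aut σ u) (aut σ v)
  aut-adj σ = proj₁ (preserve σ _ _)

  aut⁻¹-adj : ∀ (σ : Automorphism G) {u v} → Adj G u v → Adj G (aut⁻¹ σ u) (aut⁻¹ σ v)
  aut⁻¹-adj σ {u} {v} uv =
    proj₂ (preserve σ _ _) (subst₂ (Adj G) (sym (aut-aut⁻¹ σ u)) (sym (aut-aut⁻¹ σ v)) uv)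

  transport : ∀ (σ : Automorphism G) {x} → RootedTree x → RootedTree (aut σ x)
  transport σ {x} R = record
    { spanning = record
      { parent = λ y → aut σ (parent (aut⁻¹ σ y))
      ; depth = λ y → depth (aut⁻¹ σ y)
      ; depth-root = trans (cong depth (aut⁻¹-aut σ x)) depth-root
      ; parent-adj = λ y y≢σx → subst (Adj G _) (aut-aut⁻¹ σ y) (aut-adj σ (parent-adj _ (moved y≢σx)))
      ; depth-parent = λ y y≢σx →
          trans (depth-parent _ (moved y≢σx)) (cong (λ p → suc (depth p)) (sym (aut⁻¹-aut σ _))) }
    ; tree-edge = λ u v uv → Sum.map lift lift (tree-edge _ _ (aut⁻¹-adj σ uv)) }
    where
    open RootedTree R
    moved : ∀ {y} → y ≢ aut σ x → aut⁻¹ σ y ≢ x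
    moved y≢σx e = y≢σx (trans (sym (aut-aut⁻¹ σ _)) (cong (aut σ) e))
    lift : ∀ {u v} → aut⁻¹ σ v ≢ x × parent (aut⁻¹ σ v) ≡ aut⁻¹ σ u →
           v ≢ aut σ x × aut σ (parent (aut⁻¹ σ v)) ≡ u
    lift {u} (v≢x , e) = (λ v≡σx → v≢x (trans (cong (aut⁻¹ σ) v≡σx) (aut⁻¹-aut σ x)))
                       , trans (cong (aut σ) e) (aut-aut⁻¹ σ u)

  aut-depth : ∀ (σ : Automorphism G) {x y} (R : RootedTree x) (R' : RootedTree y) → aut σ x ≡ y →
              ∀ v → RootedTree.depth R' (aut σ v) ≡ RootedTree.depth R v
  aut-depth σ R R' σx≡y v =
    trans (sym (depth-unique σx≡y (transport σ R) R' (aut σ v)))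
          (cong (RootedTree.depth R) (aut⁻¹-aut σ v))

  aut-parent : ∀ (σ : Automorphism G) {x y} (R : RootedTree x) (R' : RootedTree y) → aut σ x ≡ y →
               ∀ v → v ≢ x → RootedTree.parent R' (aut σ v) ≡ aut σ (RootedTree.parent R v)
  aut-parent σ R R' σx≡y v v≢x =
    trans (parent-unique σx≡y (transport σ R) R' (aut σ v) (v≢x ∘ aut-injective σ))
          (cong (aut σ ∘ RootedTree.parent R) (aut⁻¹-aut σ v))

  module Subtrees {r} (P : RootedTree r) where
    open RootedTree P

    data Below (w : Fin n) : Fin n → Set where
      self  : Below w w
      child : ∀ {t} → t ≢ r → Below w (parent t) → Below w t

    below-not-root : ∀ {w t} → w ≢ r → Below w t → t ≢ r
    below-not-root w≢r self = w≢r
    below-not-root _ (child t≢r _) = t≢r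

    branch : ∀ t → t ≢ r → Σ (Fin n) λ w → parent w ≡ r × w ≢ r × Below w t
    branch t = climbing (depth t) t ≤-refl
      where
      climbing : ∀ k t → depth t ≤ k → t ≢ r → Σ (Fin n) λ w → parent w ≡ r × w ≢ r × Below w t
      climbing _ t _ t≢r with parent t ≟ r
      climbing _ t _ t≢r | yes pt≡r = t , pt≡r , t≢r , self
      climbing zero t dt≤0 t≢r | no _ =
        contradiction (trans (sym (n≤0⇒n≡0 dt≤0)) (depth-parent t t≢r)) λ ()
      climbing (suc k) t dt≤k t≢r | no pt≢r
        with climbing k (parent t) (≤-pred (subst (_≤ suc k) (depth-parent t t≢r) dt≤k)) pt≢r
      ... | w , pw≡r , w≢r , below = w , pw≡r , w≢r , child t≢r below

    -- If, in the tree Z rooted at z, the child w of r hangs from r (z is on r's side of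
    -- the edge r–w), then Z agrees with P below w, which lies farther from z than w.
    farther : ∀ {z} (Z : RootedTree z) {w} → w ≢ r → RootedTree.parent Z w ≡ r → ∀ {t} → Below w t →
              t ≡ w ⊎ (RootedTree.parent Z t ≡ parent t × RootedTree.depth Z w < RootedTree.depth Z t)
    farther Z w≢r pZw≡r self = inj₁ refl
    farther Z {w} w≢r pZw≡r {t} (child t≢r below)
      with RootedTree.tree-edge Z (parent t) t (parent-adj t t≢r)
    ... | inj₁ (t≢z , pZt≡pt) = inj₂ (pZt≡pt , ≤-<-trans w≤pt pt<t)
      where
      pt<t : RootedTree.depth Z (parent t) < RootedTree.depth Z t
      pt<t = subst (λ p → RootedTree.depth Z p < _) pZt≡pt (RootedTree.shallower Z t t≢z)
      w≤pt : RootedTree.depth Z w ≤ RootedTree.depth Z (parent t)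
      w≤pt with farther Z w≢r pZw≡r below
      ... | inj₁ pt≡w = ≤-reflexive (cong (RootedTree.depth Z) (sym pt≡w))
      ... | inj₂ (_ , w<pt) = <⇒≤ w<pt
    ... | inj₂ (_ , pZpt≡t) with farther Z w≢r pZw≡r below
    ...   | inj₁ refl = contradiction (trans (sym pZpt≡t) pZw≡r) t≢r
    ...   | inj₂ (pZpt≡ppt , _) = contradiction loop (m≢1+n+m (depth t))
      where
      -- t would be its own grandparent in P
      loop : depth t ≡ suc (suc (depth t))
      loop = begin
        depth t                           ≡⟨ depth-parent t t≢r ⟩
        suc (depth (parent t))            ≡⟨ cong suc (depth-parent _ (below-not-root w≢r below)) ⟩
        suc (suc (depth (parent (parent t))))
          ≡⟨ cong (λ p → suc (suc (depth p))) (trans (sym pZpt≡ppt) pZpt≡t) ⟩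
        suc (suc (depth t))               ∎
        where open ≡-Reasoning

  module Centre (tree : IsTree G) where

    dist : Fin n → Fin n → ℕ
    dist z = RootedTree.depth (rootedTree tree z)

    -- Automorphisms are isometries, so they do not increase eccentricities.
    dist-aut : ∀ (σ : Automorphism G) z y → dist (aut σ z) (aut σ y) ≡ dist z y
    dist-aut σ z y = aut-depth σ (rootedTree tree z) (rootedTree tree (aut σ z)) refl y

    ecc : Fin n → ℕ
    ecc y = dist (argmax (λ z → dist z y) y (allFin n)) y

    dist≤ecc : ∀ z y → dist z y ≤ ecc y
    dist≤ecc z y = All.lookup (f[xs]≤f[argmax] {f = λ z → dist z y} y (allFin n)) (∈-allFin z)

    ecc< : ∀ y {M} → (∀ z → dist z y < M) → ecc y < M
    ecc< y below = f[argmax]<v⁺ {f = λ z → dist z y} {xs = allFin n}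
                                (below y) (All.tabulate λ {z} _ → below z)

    ecc-aut : ∀ (σ : Automorphism G) y → ecc (aut σ y) ≤ ecc y
    ecc-aut σ y = f[argmax]≤v⁺ {f = λ z → dist z (aut σ y)} {xs = allFin n}
                               (far (aut σ y)) (All.tabulate λ {z} _ → far z)
      where
      far : ∀ z → dist z (aut σ y) ≤ ecc y
      far z = subst (λ u → dist u (aut σ y) ≤ ecc y) (aut-aut⁻¹ σ z)
                    (subst (_≤ ecc y) (sym (dist-aut σ (aut⁻¹ σ z) y)) (dist≤ecc (aut⁻¹ σ z) y))

    IsCentre : Fin n → Set
    IsCentre r = ∀ y → ecc r ≤ ecc y

    centre : Fin n → Σ (Fin n) IsCentre
    centre v = argmin ecc v (allFin n)
             , λ y → All.lookup (f[argmin]≤f[xs] {f = ecc} v (allFin n)) (∈-allFin y)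

    module _ {r} (central : IsCentre r) where
      P : RootedTree r
      P = rootedTree tree r
      open RootedTree P
      open Subtrees P

      closer : ∀ (σ : Automorphism G) {w} → parent w ≡ r → w ≢ r → Below w (aut σ r) → aut σ r ≢ w →
               ∀ z → dist z w < ecc r
      closer σ {w} pw≡r w≢r below σr≢w z
        with RootedTree.tree-edge (rootedTree tree z) r w (hangs-from w≢r pw≡r)
      ... | inj₁ (_ , pZw≡r) with farther (rootedTree tree z) w≢r pZw≡r below
      ...   | inj₁ σr≡w = contradiction σr≡w σr≢w
      ...   | inj₂ (_ , w<σr) = <-≤-trans w<σr (≤-trans (dist≤ecc z (aut σ r)) (ecc-aut σ r))
      closer σ {w} pw≡r w≢r below σr≢w z | inj₂ (r≢z , pZr≡w) =
        <-≤-trans (subst (λ p → dist z p < dist z r) pZr≡w (RootedTree.shallower (rootedTree tree z) r r≢z))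
                  (dist≤ecc z r)

      centre-aut : ∀ (σ : Automorphism G) → aut σ r ≡ r ⊎ Adj G r (aut σ r)
      centre-aut σ with aut σ r ≟ r
      ... | yes fixed = inj₁ fixed
      ... | no σr≢r with parent (aut σ r) ≟ r
      ...   | yes pσr≡r = inj₂ (hangs-from σr≢r pσr≡r)
      ...   | no pσr≢r with branch (aut σ r) σr≢r
      ...     | w , pw≡r , w≢r , below =
        contradiction (central w) (<⇒≱ (ecc< w (closer σ pw≡r w≢r below σr≢w)))
        where
        σr≢w : aut σ r ≢ w
        σr≢w σr≡w = pσr≢r (trans (cong parent σr≡w) pw≡r)

  module Recolouring {r d} (P : RootedTree r) (c : Coloring n d) where
    open RootedTree P

    colourAt : ℕ → Fin n → Fin (suc d)
    colourAt zero v = inject₁ (c v)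
    colourAt (suc k) v = avoid (c v) (colourAt k (parent v))

    c' : Coloring n (suc d)
    c' v = colourAt (depth v) v

    c'-parent : ∀ v → v ≢ r → c' v ≡ avoid (c v) (c' (parent v))
    c'-parent v v≢r = cong (λ k → colourAt k v) (depth-parent v v≢r)

    c'-avoids-parent : ∀ v → v ≢ r → c' (parent v) ≢ c' v
    c'-avoids-parent v v≢r e = avoid-≢ (c v) (c' (parent v)) (trans (sym (c'-parent v v≢r)) (sym e))

    -- Every edge joins a vertex to its parent, whose colour it avoids.
    c'-proper : Proper G c'
    c'-proper u v uv with tree-edge u v uv
    ... | inj₁ (v≢r , refl) = c'-avoids-parent v v≢r
    ... | inj₂ (u≢r , refl) = c'-avoids-parent u u≢r ∘ sym

    c-recovered : ∀ v → v ≢ r → inject₁ (c v) ≡ recover (c' v) (c' (parent v))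
    c-recovered v v≢r = trans (sym (recover-avoid (c v) _))
                              (cong (λ a → recover a (c' (parent v))) (sym (c'-parent v v≢r)))

    c'-distinguishing : (∀ (σ : Automorphism G) → aut σ r ≡ r ⊎ Adj G r (aut σ r)) →
                        Distinguishing G c → Distinguishing G c'
    c'-distinguishing centre-aut c-dist σ keeps = c-dist σ keeps-c
      where
      fixed : aut σ r ≡ r
      fixed = [ id , (λ adj → contradiction (sym (keeps r)) (c'-proper r _ adj)) ] (centre-aut σ)
      keeps-c : ∀ v → c (aut σ v) ≡ c v
      keeps-c v with v ≟ r
      ... | yes refl = cong c fixed
      ... | no v≢r = inject₁-injective (begin
        inject₁ (c (aut σ v))                              ≡⟨ c-recovered (aut σ v) σv≢r ⟩
        recover (c' (aut σ v)) (c' (parent (aut σ v)))     ≡⟨ cong₂ recover (keeps v) σ-parent ⟩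
        recover (c' v) (c' (parent v))                     ≡⟨ sym (c-recovered v v≢r) ⟩
        inject₁ (c v)                                      ∎)
        where
        open ≡-Reasoning
        σv≢r : aut σ v ≢ r
        σv≢r σv≡r = v≢r (aut-injective σ (trans σv≡r (sym fixed)))
        σ-parent : c' (parent (aut σ v)) ≡ c' (parent v)
        σ-parent = trans (cong c' (aut-parent σ P P fixed v v≢r)) (keeps (parent v))

  recolourAtCentre : (tree : IsTree G) → Σ (Fin n) (Centre.IsCentre tree) →
                     ∀ {d} (c : Coloring n d) → Distinguishing G c → HasProperDistColoring G (suc d)
  recolourAtCentre tree (r , central) c c-dist =
    c' , c'-proper , c'-distinguishing (Centre.centre-aut tree central) c-dist
    where open Recolouring (rootedTree tree r) c

properDistinguishing : ∀ {n} (T : Graph n) → IsTree T → ∀ {d} →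
                       HasDistColoring T d → HasProperDistColoring T (suc d)
properDistinguishing {zero} T _ _ = (λ ()) , (λ ()) , (λ _ _ ())
properDistinguishing {suc n} T tree (c , c-dist) =
  recolourAtCentre T tree (Centre.centre T tree zero) c c-dist

mainTheorem11 : ∀ {n : ℕ} (T : Graph n) → IsTree T →
    ∀ (d x : ℕ) → IsDistNumber T d → IsDistChromaticNumber T x → x ≤ d + 1
mainTheorem11 T tree d x (d-colouring , _) (_ , x-least) =
  subst (x ≤_) (+-comm 1 d) (x-least (suc d) (properDistinguishing T tree d-colouring))
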